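{- Let $n\ge 2k$ and let $\mathcal{F}$ be a $k$-uniform MLCIF on $[n]$. If $F$ is a strong set in $\mathcal{F}$, then every $G\in\mathcal{F}$ has $\iota(G)\le\iota(F)$.
   Context: For $G=\{y_1<\dots<y_k\}$, $F=\{x_1<\dots<x_k\}$ in $\binom{[n]}{k}$, write $G\leq_{\mathrm{LC}} F$ if $y_i\le x_i$ for all $i$. A $k$-uniform MLCIF on $[n]$ is a family $\mathcal{F}\subseteq\binom{[n]}{k}$ that is intersecting, closed under $\leq_{\mathrm{LC}}$-smaller sets, and maximal under inclusion among such families. For $i\in[k]$ let $Z_i:=[i,2i-1]\cup[n-k+i+1,n]$. For $F\in\mathcal{F}$, the index $\iota(F)$ is the smallest $i\in[k]$ with $F\leq_{\mathrm{LC}} Z_i$ (such an $i$ always exists when $n \ge 2k$). A set $F\in\mathcal{F}$ is a strong set in $\mathcal{F}$ if $|F\cap[2k+1,n]|=k-\iota(F)$. -}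

module Defs where

open import Data.Nat using (ℕ; _+_; _*_; _∸_; _≤_; _<_; _≤?_; _<?_)
open import Data.Fin using (Fin; toℕ)
import Data.Fin as Fin
open import Data.Vec using (Vec; lookup; tabulate; count)
open import Data.Vec.Membership.Propositional using (_∈_)
open import Data.Product using (_×_; ∃)
open import Relation.Nullary using (¬_)
open import Data.Bool using (if_then_else_)
open import Relation.Binary.PropositionalEquality using (_≡_)
open import Relation.Nullary.Decidable using (does)

-- A k-subset of [n] = {1,…,n} is represented by its elements listed in
-- strictly increasing order: a vector (y₁ < … < yₖ) with 1 ≤ yᵢ ≤ n.
IsKSet : ℕ → (k : ℕ) → Vec ℕ k → Set
IsKSet n k v =
  (∀ (i : Fin k) → 1 ≤ lookup v i × lookup v i ≤ n) ×
  (∀ (i j : Fin k) → i Fin.< j → lookup v i < lookup v j)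

_≤LC_ : ∀ {k} → Vec ℕ k → Vec ℕ k → Set
G ≤LC F = ∀ i → lookup G i ≤ lookup F i

Family : ℕ → Set₁
Family k = Vec ℕ k → Set

_⊆F_ : ∀ {k} → Family k → Family k → Set
𝓕 ⊆F 𝓖 = ∀ A → 𝓕 A → 𝓖 A

IsLCIF : (n k : ℕ) → Family k → Set
IsLCIF n k 𝓕 =
  (∀ A → 𝓕 A → IsKSet n k A) ×
  (∀ A B → 𝓕 A → 𝓕 B → ∃ λ x → x ∈ A × x ∈ B) ×
  (∀ F G → 𝓕 F → IsKSet n k G → G ≤LC F → 𝓕 G)

IsMLCIF : (n k : ℕ) → Family k → Set₁
IsMLCIF n k 𝓕 =
  IsLCIF n k 𝓕 ×
  (∀ (𝓖 : Family k) → IsLCIF n k 𝓖 → 𝓕 ⊆F 𝓖 → 𝓖 ⊆F 𝓕)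

-- Z_i = [i, 2i-1] ∪ [n-k+i+1, n], as an increasing vector of length k.
-- The (0-based) j-th entry is i + j for j < i and n - k + 1 + j for j ≥ i.
Z : (n k i : ℕ) → Vec ℕ k
Z n k i = tabulate λ (j : Fin k) →
  if does (_<?_ (toℕ j) i) then i + toℕ j else n ∸ k + 1 + toℕ j

IsIndex : (n k : ℕ) → Vec ℕ k → ℕ → Set
IsIndex n k F i =
  1 ≤ i × i ≤ k × F ≤LC Z n k i ×
  (∀ j → 1 ≤ j → j < i → ¬ (F ≤LC Z n k j))

-- |F ∩ [2k+1, n]|  (elements of F are ≤ n already)
bigPart : (k : ℕ) → Vec ℕ k → ℕ
bigPart k F = count (2 * k + 1 ≤?_) F

IsStrong : (n k : ℕ) → Family k → Vec ℕ k → ℕ → Set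
IsStrong n k 𝓕 F i = 𝓕 F × IsIndex n k F i × bigPart k F ≡ k ∸ i

-- Suppose ι(G) > ι(F) = i. Minimality of ι(F) forces F to lie above 1, 3, …, 2i−1 in its
-- first i positions, and since F is strong its last k − i entries all exceed 2k; minimality
-- of ι(G) forces G to lie above 2, 4, …, 2i in its first i positions and hence above
-- 2i+1, …, k+i afterwards. So F dominates H = {1, 3, …, 2i−1} ∪ [2k+1, 3k−i] and G dominates
-- H′ = {2, 4, …, 2i} ∪ [2i+1, k+i]. Closedness puts the disjoint sets H and H′ into 𝓕,
-- contradicting that 𝓕 is intersecting.
module Submission where

open import Defs
open import Data.Nat using (ℕ; zero; suc; _+_; _*_; _∸_; _≤_; _<_; _≤?_; _<?_; z≤n; s≤s; z<s)
open import Data.Nat.Properties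
open import Data.Nat.Tactic.RingSolver using (solve-∀)
open import Data.Fin using (Fin; toℕ; fromℕ<; fromℕ)
import Data.Fin as Fin
open import Data.Fin.Properties using (toℕ-injective; toℕ-fromℕ<; toℕ<n; toℕ-fromℕ)
open import Data.Vec using (Vec; lookup; tabulate; count; _∷_)
open import Data.Vec.Properties using (lookup∘tabulate; count≤n)
open import Data.Vec.Membership.Propositional using (_∈_)
open import Data.Vec.Relation.Unary.Any.Properties using (tabulate⁻)
open import Data.Product using (_×_; _,_; proj₁; proj₂; ∃)
open import Data.Bool using (if_then_else_)
open import Function using (_∘_)
open import Relation.Nullary using (¬_; yes; no; does)
open import Relation.Nullary.Negation using (contradiction)
open import Relation.Nullary.Decidable using (dec-true; dec-false)
open import Relation.Unary using (Pred; Decidable)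
open import Relation.Binary.PropositionalEquality

2*m≡m+m : ∀ m → 2 * m ≡ m + m
2*m≡m+m m = cong (m +_) (+-identityʳ m)

x+[p∸j]<2[1+p]⇒x≤1+p+j : ∀ {x p j} → j ≤ p → x + (p ∸ j) < 2 * suc p → x ≤ suc p + j
x+[p∸j]<2[1+p]⇒x≤1+p+j {x} {p} {j} j≤p x+d<2[1+p] with p ∸ j | m∸n+n≡m j≤p
... | d | refl = +-cancelʳ-≤ d x _ (≤-pred (subst (suc (x + d) ≤_) (expand d j) x+d<2[1+p]))
  where
  expand : ∀ d j → 2 * suc (d + j) ≡ suc (suc (d + j) + j + d)
  expand = solve-∀

2[1+i]+[m∸i]≡2+i+m : ∀ {i m} → i ≤ m → 2 * suc i + (m ∸ i) ≡ suc (suc i + m)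
2[1+i]+[m∸i]≡2+i+m {i} {m} i≤m with m ∸ i | m∸n+n≡m i≤m
... | d | refl = regroup d i
  where
  regroup : ∀ d i → 2 * suc i + d ≡ suc (suc i + (d + i))
  regroup = solve-∀

count+t≤n : ∀ {a p} {A : Set a} {P : Pred A p} (P? : Decidable P) {k t} (v : Vec A k) →
            t ≤ k → (∀ (m : Fin k) → toℕ m < t → ¬ P (lookup v m)) → count P? v + t ≤ k
count+t≤n P? {t = zero}  v       _         _ = ≤-trans (≤-reflexive (+-identityʳ _)) (count≤n P? v)
count+t≤n P? {t = suc t} (x ∷ v) (s≤s t≤k) ¬P with P? x
... | yes Px = contradiction Px (¬P Fin.zero z<s)
... | no  _  = ≤-trans (≤-reflexive (+-suc _ t))
                 (s≤s (count+t≤n P? v t≤k (λ m m<t → ¬P (Fin.suc m) (s≤s m<t))))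

module IncreasingVec {n k : ℕ} (X : Vec ℕ k) (X-set : IsKSet n k X) where

  lookup-+-∸-≤ : ∀ {a b : Fin k} → toℕ a ≤ toℕ b → lookup X a + (toℕ b ∸ toℕ a) ≤ lookup X b
  lookup-+-∸-≤ {a} {b} a≤b = go (toℕ b ∸ toℕ a) b (m∸n+n≡m a≤b)
    where
    go : ∀ d b → d + toℕ a ≡ toℕ b → lookup X a + d ≤ lookup X b
    go zero    b eq = ≤-reflexive (trans (+-identityʳ _) (cong (lookup X) (toℕ-injective eq)))
    go (suc d) b eq = begin
      lookup X a + suc d   ≡⟨ +-suc _ d ⟩
      suc (lookup X a + d) ≤⟨ s≤s (go d c (sym toℕc)) ⟩
      suc (lookup X c)     ≤⟨ proj₂ X-set c b (≤-reflexive (trans (cong suc toℕc) eq)) ⟩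
      lookup X b           ∎
      where
      open ≤-Reasoning
      c<k : d + toℕ a < k
      c<k = <⇒≤ (subst (_< k) (sym eq) (toℕ<n b))
      c : Fin k
      c = fromℕ< c<k
      toℕc : toℕ c ≡ d + toℕ a
      toℕc = toℕ-fromℕ< c<k

  lookup-mono-≤ : ∀ {a b : Fin k} → toℕ a ≤ toℕ b → lookup X a ≤ lookup X b
  lookup-mono-≤ a≤b = m+n≤o⇒m≤o _ (lookup-+-∸-≤ a≤b)

  ≤lookup⇒+∸≤lookup : ∀ {a c} (a<k : a < k) → c ≤ lookup X (fromℕ< a<k) →
                      (b : Fin k) → a ≤ toℕ b → c + (toℕ b ∸ a) ≤ lookup X b
  ≤lookup⇒+∸≤lookup {a} {c} a<k c≤Xa b a≤b =
    subst (λ t → c + (toℕ b ∸ t) ≤ lookup X b) toℕa≡a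
      (≤-trans (+-monoˡ-≤ _ c≤Xa) (lookup-+-∸-≤ (subst (_≤ toℕ b) (sym toℕa≡a) a≤b)))
    where
    toℕa≡a : toℕ (fromℕ< a<k) ≡ a
    toℕa≡a = toℕ-fromℕ< a<k

  count≡k∸i⇒≤lookup : ∀ c {i} (i<k : i < k) → count (c ≤?_) X ≡ k ∸ i → c ≤ lookup X (fromℕ< i<k)
  count≡k∸i⇒≤lookup c {i} i<k count≡k∸i = ≮⇒≥ λ Xi<c → 1+n≰n (begin
    suc k                    ≡⟨ cong suc (m∸n+n≡m (<⇒≤ i<k)) ⟨
    suc (k ∸ i + i)          ≡⟨ +-suc (k ∸ i) i ⟨
    k ∸ i + suc i            ≡⟨ cong (_+ suc i) count≡k∸i ⟨
    count (c ≤?_) X + suc i  ≤⟨ count+t≤n (c ≤?_) X i<k (first-entries-small Xi<c) ⟩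
    k                        ∎)
    where
    open ≤-Reasoning
    first-entries-small : lookup X (fromℕ< i<k) < c →
                          ∀ (m : Fin k) → toℕ m < suc i → ¬ c ≤ lookup X m
    first-entries-small Xi<c m m<1+i c≤Xm = <⇒≱ Xi<c (≤-trans c≤Xm
      (lookup-mono-≤ (subst (toℕ m ≤_) (sym (toℕ-fromℕ< i<k)) (≤-pred m<1+i))))

lookup≤n∸k+1+j : ∀ {n k} (X : Vec ℕ k) → IsKSet n k X → k ≤ n →
                 (j : Fin k) → lookup X j ≤ n ∸ k + 1 + toℕ j
lookup≤n∸k+1+j {n} {suc k′} X X-set k≤n j = +-cancelʳ-≤ (suc k′) _ _ (begin
  lookup X j + suc k′                ≡⟨ cong (lookup X j +_) (sym gap+1+j≡k) ⟩
  lookup X j + (gap + suc (toℕ j))    ≡⟨ +-assoc (lookup X j) gap _ ⟨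
  lookup X j + gap + suc (toℕ j)      ≤⟨ +-monoˡ-≤ (suc (toℕ j)) (≤-trans j+gap≤last last≤n) ⟩
  n + suc (toℕ j)                    ≡⟨ cong (_+ suc (toℕ j)) (m∸n+n≡m k≤n) ⟨
  n ∸ suc k′ + suc k′ + suc (toℕ j)    ≡⟨ shuffle (n ∸ suc k′) (suc k′) (toℕ j) ⟩
  n ∸ suc k′ + 1 + toℕ j + suc k′     ∎)
  where
  open ≤-Reasoning
  open IncreasingVec X X-set
  last : Fin (suc k′)
  last = fromℕ k′
  gap : ℕ
  gap = k′ ∸ toℕ j
  gap+1+j≡k : gap + suc (toℕ j) ≡ suc k′
  gap+1+j≡k = trans (+-suc gap (toℕ j)) (cong suc (m∸n+n≡m (≤-pred (toℕ<n j))))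
  j+gap≤last : lookup X j + gap ≤ lookup X last
  j+gap≤last = subst (λ t → lookup X j + (t ∸ toℕ j) ≤ lookup X last) (toℕ-fromℕ k′)
                 (lookup-+-∸-≤ (subst (toℕ j ≤_) (sym (toℕ-fromℕ k′)) (≤-pred (toℕ<n j))))
  last≤n : lookup X last ≤ n
  last≤n = proj₂ (proj₁ X-set last)
  shuffle : ∀ a b c → a + b + suc c ≡ a + 1 + c + b
  shuffle = solve-∀

lookup-Z : ∀ n k i (j : Fin k) →
           lookup (Z n k i) j ≡ (if does (toℕ j <? i) then i + toℕ j else n ∸ k + 1 + toℕ j)
lookup-Z n k i = lookup∘tabulate _

lookup-Z-< : ∀ n k i (j : Fin k) → toℕ j < i → lookup (Z n k i) j ≡ i + toℕ j
lookup-Z-< n k i j j<i = trans (lookup-Z n k i j)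
  (cong (if_then i + toℕ j else n ∸ k + 1 + toℕ j) (dec-true (toℕ j <? i) j<i))

lookup-Z-≮ : ∀ n k i (j : Fin k) → ¬ toℕ j < i → lookup (Z n k i) j ≡ n ∸ k + 1 + toℕ j
lookup-Z-≮ n k i j j≮i = trans (lookup-Z n k i j)
  (cong (if_then i + toℕ j else n ∸ k + 1 + toℕ j) (dec-false (toℕ j <? i) j≮i))

lookup<2[1+p]⇒≤LC-Z : ∀ {n k} (X : Vec ℕ k) → IsKSet n k X → k ≤ n → (p : Fin k) →
                       lookup X p < 2 * suc (toℕ p) → X ≤LC Z n k (suc (toℕ p))
lookup<2[1+p]⇒≤LC-Z {n} {k} X X-set k≤n p Xp<2[1+p] j with toℕ j <? suc (toℕ p)
... | yes j<1+p = subst (lookup X j ≤_) (sym (lookup-Z-< n k _ j j<1+p))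
  (x+[p∸j]<2[1+p]⇒x≤1+p+j (≤-pred j<1+p) (≤-<-trans (lookup-+-∸-≤ (≤-pred j<1+p)) Xp<2[1+p]))
  where open IncreasingVec X X-set
... | no j≮1+p = subst (lookup X j ≤_) (sym (lookup-Z-≮ n k _ j j≮1+p)) (lookup≤n∸k+1+j X X-set k≤n j)

-- Read at 0-based positions m < k, these are the sets H = {1, 3, …, 2i−1} ∪ [2k+1, 3k−i]
-- and H′ = {2, 4, …, 2i} ∪ [2i+1, k+i].
oddsThenTop : (k i m : ℕ) → ℕ
oddsThenTop k i m with m <? i
... | yes _ = suc (2 * m)
... | no  _ = suc (2 * k + (m ∸ i))

evensThenMiddle : (i m : ℕ) → ℕ
evensThenMiddle i m with m <? i
... | yes _ = 2 * suc m
... | no  _ = suc (i + m)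

oddsThenTop-positive : ∀ k i m → 1 ≤ oddsThenTop k i m
oddsThenTop-positive k i m with m <? i
... | yes _ = s≤s z≤n
... | no  _ = s≤s z≤n

evensThenMiddle-positive : ∀ i m → 1 ≤ evensThenMiddle i m
evensThenMiddle-positive i m with m <? i
... | yes _ = s≤s z≤n
... | no  _ = s≤s z≤n

oddsThenTop-strictMono : ∀ {k i a b} → i ≤ k → a < b → oddsThenTop k i a < oddsThenTop k i b
oddsThenTop-strictMono {k} {i} {a} {b} i≤k a<b with a <? i | b <? i
... | yes _   | yes _   = s≤s (*-monoʳ-< 2 a<b)
... | yes a<i | no  _   = s≤s (<-≤-trans (*-monoʳ-< 2 (<-≤-trans a<i i≤k)) (m≤m+n _ _))
... | no  a≮i | yes b<i = contradiction (<-trans a<b b<i) a≮i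
... | no  a≮i | no  _   = s≤s (+-monoʳ-< (2 * k) (∸-monoˡ-< a<b (≮⇒≥ a≮i)))

evensThenMiddle-strictMono : ∀ {i a b} → a < b → evensThenMiddle i a < evensThenMiddle i b
evensThenMiddle-strictMono {i} {a} {b} a<b with a <? i | b <? i
... | yes _   | yes _   = *-monoʳ-< 2 (s≤s a<b)
... | yes a<i | no  _   = s≤s (subst (_≤ i + b) (sym (2*m≡m+m (suc a))) (+-mono-≤ a<i a<b))
... | no  a≮i | yes b<i = contradiction (<-trans a<b b<i) a≮i
... | no  _   | no  _   = s≤s (+-monoʳ-< i a<b)

oddsThenTop≢evensThenMiddle : ∀ {k i a b} → i ≤ k → b < k → oddsThenTop k i a ≢ evensThenMiddle i b
oddsThenTop≢evensThenMiddle {k} {i} {a} {b} i≤k b<k with a <? i | b <? i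
... | yes _   | yes _   = even≢odd (suc b) a ∘ sym
... | yes a<i | no  b≮i =
  <⇒≢ (s≤s (subst (_< i + b) (sym (2*m≡m+m a)) (+-mono-< a<i (<-≤-trans a<i (≮⇒≥ b≮i)))))
... | no  _   | yes b<i = ≢-sym (<⇒≢ (s≤s (≤-trans (*-monoʳ-≤ 2 (≤-trans b<i i≤k)) (m≤m+n _ _))))
... | no  _   | no  _   = ≢-sym (<⇒≢ (s≤s (≤-trans (+-mono-≤-< i≤k b<k)
                            (subst (_≤ 2 * k + (a ∸ i)) (2*m≡m+m k) (m≤m+n _ _)))))

IndexAtLeast : (n k ι : ℕ) → Vec ℕ k → Set
IndexAtLeast n k ι X = ∀ j → 1 ≤ j → j < ι → ¬ X ≤LC Z n k j

module LargeIndex {n k ι : ℕ} (X : Vec ℕ k) (X-set : IsKSet n k X) (k≤n : k ≤ n)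
                  (X-index≥ι : IndexAtLeast n k ι X) where

  open IncreasingVec X X-set

  2[1+m]≤lookup : (m : Fin k) → suc (toℕ m) < ι → 2 * suc (toℕ m) ≤ lookup X m
  2[1+m]≤lookup m 1+m<ι = ≮⇒≥ λ Xm<2[1+m] →
    X-index≥ι (suc (toℕ m)) (s≤s z≤n) 1+m<ι (lookup<2[1+p]⇒≤LC-Z X X-set k≤n m Xm<2[1+m])

  2[1+a]≤lookup-fromℕ< : ∀ {a} (a<k : a < k) → suc a < ι → 2 * suc a ≤ lookup X (fromℕ< a<k)
  2[1+a]≤lookup-fromℕ< a<k 1+a<ι =
    subst (λ t → 2 * suc t ≤ lookup X (fromℕ< a<k)) (toℕ-fromℕ< a<k)
      (2[1+m]≤lookup (fromℕ< a<k) (subst (λ t → suc t < ι) (sym (toℕ-fromℕ< a<k)) 1+a<ι))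

  1+2m≤lookup : (m : Fin k) → toℕ m < ι → suc (2 * toℕ m) ≤ lookup X m
  1+2m≤lookup m m<ι with toℕ m in toℕm≡
  ... | zero   = proj₁ (proj₁ X-set m)
  ... | suc m′ = ≤-trans (s≤s (2[1+a]≤lookup-fromℕ< m′<k m<ι))
                   (proj₂ X-set (fromℕ< m′<k) m
                     (≤-reflexive (trans (cong suc (toℕ-fromℕ< m′<k)) (sym toℕm≡))))
    where
    m′<k : m′ < k
    m′<k = <-trans (n<1+n m′) (subst (_< k) toℕm≡ (toℕ<n m))

  1+i+m≤lookup : ∀ {i} → 1 ≤ i → i < ι → (m : Fin k) → i ≤ toℕ m → suc (i + toℕ m) ≤ lookup X m
  1+i+m≤lookup {suc i′} _ i<ι m i≤m = subst (_≤ lookup X m) (2[1+i]+[m∸i]≡2+i+m (<⇒≤ i≤m))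
    (≤lookup⇒+∸≤lookup i′<k (2[1+a]≤lookup-fromℕ< i′<k i<ι) m (<⇒≤ i≤m))
    where
    i′<k : i′ < k
    i′<k = <-≤-trans i≤m (<⇒≤ (toℕ<n m))

  oddsThenTop≤lookup : bigPart k X ≡ k ∸ ι → (m : Fin k) → oddsThenTop k ι (toℕ m) ≤ lookup X m
  oddsThenTop≤lookup X-strong m with toℕ m <? ι
  ... | yes m<ι = 1+2m≤lookup m m<ι
  ... | no  m≮ι = ≤lookup⇒+∸≤lookup ι<k 1+2k≤Xι m (≮⇒≥ m≮ι)
    where
    ι<k : ι < k
    ι<k = ≤-<-trans (≮⇒≥ m≮ι) (toℕ<n m)
    1+2k≤Xι : suc (2 * k) ≤ lookup X (fromℕ< ι<k)
    1+2k≤Xι = subst (_≤ lookup X (fromℕ< ι<k)) (+-comm (2 * k) 1)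
                (count≡k∸i⇒≤lookup (2 * k + 1) ι<k X-strong)

  evensThenMiddle≤lookup : ∀ {i} → 1 ≤ i → i < ι → (m : Fin k) → evensThenMiddle i (toℕ m) ≤ lookup X m
  evensThenMiddle≤lookup {i} 1≤i i<ι m with toℕ m <? i
  ... | yes m<i = 2[1+m]≤lookup m (≤-<-trans m<i i<ι)
  ... | no  m≮i = 1+i+m≤lookup 1≤i i<ι m (≮⇒≥ m≮i)

tabulate-≤LC : ∀ {k} {f : Fin k → ℕ} {X : Vec ℕ k} → (∀ m → f m ≤ lookup X m) → tabulate f ≤LC X
tabulate-≤LC {f = f} f≤X m = subst (_≤ _) (sym (lookup∘tabulate f m)) (f≤X m)

tabulate∈LCIF : ∀ {n k 𝓕} → IsLCIF n k 𝓕 → (f : ℕ → ℕ) → (∀ m → 1 ≤ f m) →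
                (∀ {a b} → a < b → f a < f b) → {X : Vec ℕ k} → 𝓕 X →
                (∀ m → f (toℕ m) ≤ lookup X m) → 𝓕 (tabulate (f ∘ toℕ))
tabulate∈LCIF (⊆[n] , _ , closed) f f-positive f-strictMono {X} X∈𝓕 f≤X =
  closed X (tabulate (f ∘ toℕ)) X∈𝓕 f-set (tabulate-≤LC {X = X} f≤X)
  where
  f-set : IsKSet _ _ (tabulate (f ∘ toℕ))
  f-set =
    (λ m → subst (1 ≤_) (sym (lookup∘tabulate (f ∘ toℕ) m)) (f-positive (toℕ m)) ,
           ≤-trans (tabulate-≤LC {X = X} f≤X m) (proj₂ (proj₁ (⊆[n] X X∈𝓕) m))) ,
    (λ a b a<b → subst₂ _<_ (sym (lookup∘tabulate (f ∘ toℕ) a)) (sym (lookup∘tabulate (f ∘ toℕ) b))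
                   (f-strictMono a<b))

tabulate-disjoint : ∀ {k} {f g : Fin k → ℕ} → (∀ a b → f a ≢ g b) →
                    ¬ ∃ λ x → x ∈ tabulate f × x ∈ tabulate g
tabulate-disjoint f≢g (x , x∈f , x∈g) with tabulate⁻ x∈f | tabulate⁻ x∈g
... | a , x≡fa | b , x≡gb = f≢g a b (trans (sym x≡fa) x≡gb)

lemma2p5 : (n k : ℕ) → 2 * k ≤ n → (𝓕 : Family k) → IsMLCIF n k 𝓕 →
    (F : Vec ℕ k) (iF : ℕ) → IsStrong n k 𝓕 F iF →
    (G : Vec ℕ k) (iG : ℕ) → 𝓕 G → IsIndex n k G iG → iG ≤ iF
lemma2p5 n k 2k≤n 𝓕 (𝓕-LCIF@(⊆[n] , intersecting , _) , _)
         F i (F∈𝓕 , (1≤i , i≤k , _ , F-index≥i) , F-strong) G j G∈𝓕 (_ , _ , _ , G-index≥j) =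
  ≮⇒≥ λ i<j → tabulate-disjoint (λ a b → oddsThenTop≢evensThenMiddle i≤k (toℕ<n b))
    (intersecting _ _ H∈𝓕 (H′∈𝓕 i<j))
  where
  k≤n : k ≤ n
  k≤n = ≤-trans (m≤m+n k _) 2k≤n
  H∈𝓕 : 𝓕 (tabulate (oddsThenTop k i ∘ toℕ))
  H∈𝓕 = tabulate∈LCIF 𝓕-LCIF (oddsThenTop k i) (oddsThenTop-positive k i)
          (oddsThenTop-strictMono i≤k) F∈𝓕
          (LargeIndex.oddsThenTop≤lookup F (⊆[n] F F∈𝓕) k≤n F-index≥i F-strong)
  H′∈𝓕 : i < j → 𝓕 (tabulate (evensThenMiddle i ∘ toℕ))
  H′∈𝓕 i<j = tabulate∈LCIF 𝓕-LCIF (evensThenMiddle i) (evensThenMiddle-positive i)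
               (evensThenMiddle-strictMono {i}) G∈𝓕
               (LargeIndex.evensThenMiddle≤lookup G (⊆[n] G G∈𝓕) k≤n G-index≥j 1≤i i<j)
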